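{- Let $p$ be a prime and let $R,S\in GF(p)[x]$ be polynomials each with constant term equal to $1$, with $\deg R\ge 1$. Suppose that $R$ and its derivative $R'$ are relatively prime and that $R$ does not divide $S$. Then for every positive integer $m$ not divisible by $p$, the polynomial $x^{\deg R+\deg S+1}$ does not divide $R(x)^mS(x)-1$. -}

module Defs where

open import Data.Nat as ℕ using (ℕ; zero; suc; _<_)
open import Data.Integer as ℤ using (ℤ; +_; _-_)
open import Data.Integer.Divisibility as ℤD using ()
open import Data.List using (List; []; _∷_; replicate; _++_; map)
open import Data.Product using (∃; _×_)
open import Relation.Binary.PropositionalEquality using (_≡_)
open import Relation.Nullary using (¬_)

-- Polynomials with integer coefficients, read modulo a prime p, represent GF(p)[x].
-- A list [a₀, a₁, …] stands for a₀ + a₁ x + a₂ x² + ⋯ .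
Poly : Set
Poly = List ℤ

coeff : Poly → ℕ → ℤ
coeff []       _       = + 0
coeff (a ∷ _)  zero    = a
coeff (_ ∷ P)  (suc i) = coeff P i

_≡[_]_ : ℤ → ℕ → ℤ → Set
a ≡[ p ] b = (+ p) ℤD.∣ (a - b)

infix 4 _≡[_]_ _≈[_]_ _∣[_]_
infixl 6 _+ₚ_ _-ₚ_
infixr 8 _^ₚ_
infixl 7 _*ₚ_

_+ₚ_ : Poly → Poly → Poly
[]      +ₚ Q       = Q
(a ∷ P) +ₚ []      = a ∷ P
(a ∷ P) +ₚ (b ∷ Q) = (a ℤ.+ b) ∷ (P +ₚ Q)

_*ₚ_ : Poly → Poly → Poly
[]      *ₚ Q = []
(a ∷ P) *ₚ Q = map (a ℤ.*_) Q +ₚ (+ 0 ∷ (P *ₚ Q))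

-ₚ_ : Poly → Poly
-ₚ P = map ℤ.-_ P

_-ₚ_ : Poly → Poly → Poly
P -ₚ Q = P +ₚ (-ₚ Q)

oneₚ : Poly
oneₚ = + 1 ∷ []

_^ₚ_ : Poly → ℕ → Poly
P ^ₚ zero  = oneₚ
P ^ₚ suc m = P *ₚ (P ^ₚ m)

Xpow : ℕ → Poly
Xpow n = replicate n (+ 0) ++ (+ 1 ∷ [])

derivFrom : ℕ → Poly → Poly
derivFrom k []      = []
derivFrom k (b ∷ P) = ((+ k) ℤ.* b) ∷ derivFrom (suc k) P

deriv : Poly → Poly
deriv []      = []
deriv (_ ∷ P) = derivFrom 1 P

_≈[_]_ : Poly → ℕ → Poly → Set
P ≈[ p ] Q = ∀ i → coeff P i ≡[ p ] coeff Q i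

_∣[_]_ : Poly → ℕ → Poly → Set
A ∣[ p ] B = ∃ λ Q → (A *ₚ Q) ≈[ p ] B

HasDegree : ℕ → Poly → ℕ → Set
HasDegree p P d = (¬ (coeff P d ≡[ p ] + 0)) × (∀ i → d < i → coeff P i ≡[ p ] + 0)

RelPrime : ℕ → Poly → Poly → Set
RelPrime p A B = ∀ D → D ∣[ p ] A → D ∣[ p ] B → HasDegree p D 0

module Submission where

-- If x^(n+1) divides F - 1, where F = R^m S and n = deg R + deg S, then x^n divides
-- F' = R^(m-1) (m R' S + R S'). Since R(0) = 1, R^(m-1) is a unit modulo x^n, so x^n divides
-- W = m R' S + R S'; but deg W < n, hence W = 0. Thus R divides m R' S, and as m is a unit
-- modulo p and R is coprime to R', Bézout's identity gives R ∣ S.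

open import Algebra.Bundles using (CommutativeRing)
open import Data.Empty using (⊥-elim)
open import Data.Integer as ℤ using (ℤ; +_; -[1+_])
import Data.Integer.Divisibility.Signed as ℤ∣
import Data.Integer.Properties as ℤP
open import Data.Integer.Tactic.RingSolver using (solve-∀)
open import Data.List using ([]; _∷_; map; length)
open import Data.Maybe using (nothing)
open import Data.Nat as ℕ using (ℕ; zero; suc; z≤n; s≤s)
open import Data.Nat.Coprimality using (Coprime; coprime-Bézout)
import Data.Nat.Divisibility as ℕ∣
open import Data.Nat.GCD using (module Bézout)
open import Data.Nat.Primality using (Prime; prime⇒irreducible)
import Data.Nat.Properties as ℕP
open import Data.Product using (Σ; _,_)
open import Data.Sum using (inj₁; inj₂)
open import Function using (_∘_)
open import Relation.Binary.Bundles using (Setoid)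
open import Relation.Binary.PropositionalEquality as ≡ using (_≡_; refl; cong; cong₂)
import Relation.Binary.Reasoning.Setoid as SetoidReasoning
open import Relation.Nullary using (¬_; Dec; yes; no)
open import Relation.Nullary.Decidable using (map′)
open import Tactic.RingSolver.Core.AlmostCommutativeRing using (AlmostCommutativeRing; fromCommutativeRing)
import Tactic.RingSolver as RingSolver

open import Defs

module PolynomialsModulo (p : ℕ) where

  open import Data.Integer using (_+_; _*_; -_; _-_)

  -- Integers modulo p

  -- A record rather than _≡[ p ]_ itself, so that a and b can be inferred from the type.
  infix 4 _≡ₘ_
  record _≡ₘ_ (a b : ℤ) : Set where
    constructor mk
    field get : a ≡[ p ] b
  open _≡ₘ_ public

  private
    p∣_ : ℤ → Set
    p∣ x = + p ℤ∣.∣ x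

    fromSigned : ∀ {a b} → p∣ (a - b) → a ≡ₘ b
    fromSigned d = mk (ℤ∣.∣⇒∣ᵤ d)

    toSigned : ∀ {a b} → a ≡ₘ b → p∣ (a - b)
    toSigned e = ℤ∣.∣ᵤ⇒∣ (get e)

  ≡ₘ-reflexive : ∀ {a b} → a ≡ b → a ≡ₘ b
  ≡ₘ-reflexive {a} refl = fromSigned (ℤ∣.divides (+ 0) (ℤP.+-inverseʳ a))

  ≡ₘ-refl : ∀ {a} → a ≡ₘ a
  ≡ₘ-refl = ≡ₘ-reflexive refl

  ≡ₘ-sym : ∀ {a b} → a ≡ₘ b → b ≡ₘ a
  ≡ₘ-sym {a} {b} e = fromSigned (≡.subst p∣_ (difference a b) (ℤ∣.∣m⇒∣-m (toSigned e)))
    where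
    difference : ∀ a b → - (a - b) ≡ b - a
    difference = solve-∀

  ≡ₘ-trans : ∀ {a b c} → a ≡ₘ b → b ≡ₘ c → a ≡ₘ c
  ≡ₘ-trans {a} {b} {c} e f = fromSigned (≡.subst p∣_ (difference a b c) (ℤ∣.∣m∣n⇒∣m+n (toSigned e) (toSigned f)))
    where
    difference : ∀ a b c → (a - b) + (b - c) ≡ a - c
    difference = solve-∀

  +-cong-≡ₘ : ∀ {a b c d} → a ≡ₘ b → c ≡ₘ d → a + c ≡ₘ b + d
  +-cong-≡ₘ {a} {b} {c} {d} e f = fromSigned (≡.subst p∣_ (difference a b c d) (ℤ∣.∣m∣n⇒∣m+n (toSigned e) (toSigned f)))
    where
    difference : ∀ a b c d → (a - b) + (c - d) ≡ (a + c) - (b + d)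
    difference = solve-∀

  *-cong-≡ₘ : ∀ {a b c d} → a ≡ₘ b → c ≡ₘ d → a * c ≡ₘ b * d
  *-cong-≡ₘ {a} {b} {c} {d} e f = fromSigned (≡.subst p∣_ (difference a b c d)
    (ℤ∣.∣m∣n⇒∣m+n (ℤ∣.∣n⇒∣m*n a (toSigned f)) (ℤ∣.∣m⇒∣m*n d (toSigned e))))
    where
    difference : ∀ a b c d → a * (c - d) + (a - b) * d ≡ a * c - b * d
    difference = solve-∀

  neg-cong-≡ₘ : ∀ {a b} → a ≡ₘ b → - a ≡ₘ - b
  neg-cong-≡ₘ {a} {b} e = fromSigned (≡.subst p∣_ (difference a b) (ℤ∣.∣m⇒∣-m (toSigned e)))
    where
    difference : ∀ a b → - (a - b) ≡ - a - - b
    difference = solve-∀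

  +-multiple-≡ₘ : ∀ a q → a + q * + p ≡ₘ a
  +-multiple-≡ₘ a q = fromSigned (ℤ∣.divides q (difference a q (+ p)))
    where
    difference : ∀ a q p → a + q * p - a ≡ q * p
    difference = solve-∀

  ℤₘ-setoid : Setoid _ _
  ℤₘ-setoid = record { Carrier = ℤ ; _≈_ = _≡ₘ_ ; isEquivalence = record { refl = ≡ₘ-refl ; sym = ≡ₘ-sym ; trans = ≡ₘ-trans } }

  module ≡ₘ-Reasoning = SetoidReasoning ℤₘ-setoid

  ∣⇒≡ₘ0 : ∀ a → p ℕ∣.∣ ℤ.∣ a ∣ → a ≡ₘ + 0
  ∣⇒≡ₘ0 a d = mk (≡.subst (p ℕ∣.∣_) (cong ℤ.∣_∣ (≡.sym (ℤP.+-identityʳ a))) d)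

  ≡ₘ0⇒∣ : ∀ a → a ≡ₘ + 0 → p ℕ∣.∣ ℤ.∣ a ∣
  ≡ₘ0⇒∣ a e = ≡.subst (p ℕ∣.∣_) (cong ℤ.∣_∣ (ℤP.+-identityʳ a)) (get e)

  _≡ₘ0? : ∀ a → Dec (a ≡ₘ + 0)
  a ≡ₘ0? = map′ (∣⇒≡ₘ0 a) (≡ₘ0⇒∣ a) (p ℕ∣.∣? ℤ.∣ a ∣)

  -- Polynomials modulo p form a commutative ring

  infix 4 _≈_
  record _≈_ (P Q : Poly) : Set where
    constructor pointwise
    field at : ∀ i → coeff P i ≡ₘ coeff Q i
  open _≈_ public

  ≈-refl : ∀ {P} → P ≈ P
  ≈-refl = pointwise λ _ → ≡ₘ-refl

  ≈-sym : ∀ {P Q} → P ≈ Q → Q ≈ P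
  ≈-sym e = pointwise λ i → ≡ₘ-sym (at e i)

  ≈-trans : ∀ {P Q T} → P ≈ Q → Q ≈ T → P ≈ T
  ≈-trans e f = pointwise λ i → ≡ₘ-trans (at e i) (at f i)

  poly-setoid : Setoid _ _
  poly-setoid = record { Carrier = Poly ; _≈_ = _≈_ ; isEquivalence = record { refl = ≈-refl ; sym = ≈-sym ; trans = ≈-trans } }

  module ≈-Reasoning = SetoidReasoning poly-setoid

  coeffwise : ∀ {P Q} {f g : ℕ → ℤ} → (∀ i → coeff P i ≡ f i) → (∀ i → f i ≡ₘ g i) → (∀ i → coeff Q i ≡ g i) → P ≈ Q
  coeffwise P≡f f≡g Q≡g = pointwise λ i → ≡ₘ-trans (≡ₘ-reflexive (P≡f i)) (≡ₘ-trans (f≡g i) (≡ₘ-reflexive (≡.sym (Q≡g i))))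

  -- By definition, (a ∷ P) *ₚ Q = scale a Q +ₚ shift (P *ₚ Q).
  scale : ℤ → Poly → Poly
  scale a Q = map (a *_) Q

  shift : Poly → Poly
  shift P = + 0 ∷ P

  coeff-+ₚ : ∀ P Q i → coeff (P +ₚ Q) i ≡ coeff P i + coeff Q i
  coeff-+ₚ []      Q       i       = ≡.sym (ℤP.+-identityˡ (coeff Q i))
  coeff-+ₚ (a ∷ P) []      i       = ≡.sym (ℤP.+-identityʳ (coeff (a ∷ P) i))
  coeff-+ₚ (a ∷ P) (b ∷ Q) zero    = refl
  coeff-+ₚ (a ∷ P) (b ∷ Q) (suc i) = coeff-+ₚ P Q i

  coeff-scale : ∀ a Q i → coeff (scale a Q) i ≡ a * coeff Q i
  coeff-scale a []      i       = ≡.sym (ℤP.*-zeroʳ a)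
  coeff-scale a (b ∷ Q) zero    = refl
  coeff-scale a (b ∷ Q) (suc i) = coeff-scale a Q i

  coeff-negₚ : ∀ P i → coeff (-ₚ P) i ≡ - coeff P i
  coeff-negₚ []      i       = refl
  coeff-negₚ (a ∷ P) zero    = refl
  coeff-negₚ (a ∷ P) (suc i) = coeff-negₚ P i

  +ₚ-cong : ∀ {P P' Q Q'} → P ≈ P' → Q ≈ Q' → P +ₚ Q ≈ P' +ₚ Q'
  +ₚ-cong {P} {P'} {Q} {Q'} e f = coeffwise (coeff-+ₚ P Q) (λ i → +-cong-≡ₘ (at e i) (at f i)) (coeff-+ₚ P' Q')

  +ₚ-congˡ : ∀ P {Q Q'} → Q ≈ Q' → P +ₚ Q ≈ P +ₚ Q'
  +ₚ-congˡ P = +ₚ-cong (≈-refl {P})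

  +ₚ-congʳ : ∀ Q {P P'} → P ≈ P' → P +ₚ Q ≈ P' +ₚ Q
  +ₚ-congʳ Q e = +ₚ-cong e (≈-refl {Q})

  -ₚ-cong : ∀ {P P'} → P ≈ P' → -ₚ P ≈ -ₚ P'
  -ₚ-cong {P} {P'} e = coeffwise (coeff-negₚ P) (λ i → neg-cong-≡ₘ (at e i)) (coeff-negₚ P')

  +ₚ-comm : ∀ P Q → P +ₚ Q ≈ Q +ₚ P
  +ₚ-comm P Q = coeffwise (coeff-+ₚ P Q) (λ i → ≡ₘ-reflexive (ℤP.+-comm (coeff P i) (coeff Q i))) (coeff-+ₚ Q P)

  +ₚ-assoc : ∀ P Q T → (P +ₚ Q) +ₚ T ≈ P +ₚ (Q +ₚ T)
  +ₚ-assoc P Q T = coeffwise lhs (λ i → ≡ₘ-reflexive (ℤP.+-assoc (coeff P i) (coeff Q i) (coeff T i))) rhs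
    where
    lhs : ∀ i → coeff ((P +ₚ Q) +ₚ T) i ≡ (coeff P i + coeff Q i) + coeff T i
    lhs i = ≡.trans (coeff-+ₚ (P +ₚ Q) T i) (cong (_+ coeff T i) (coeff-+ₚ P Q i))
    rhs : ∀ i → coeff (P +ₚ (Q +ₚ T)) i ≡ coeff P i + (coeff Q i + coeff T i)
    rhs i = ≡.trans (coeff-+ₚ P (Q +ₚ T) i) (cong (_+_ (coeff P i)) (coeff-+ₚ Q T i))

  +ₚ-identityʳ : ∀ P → P +ₚ [] ≈ P
  +ₚ-identityʳ P = coeffwise (coeff-+ₚ P []) (λ i → ≡ₘ-reflexive (ℤP.+-identityʳ (coeff P i))) (λ _ → refl)

  -ₚ‿inverseˡ : ∀ P → -ₚ P +ₚ P ≈ []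
  -ₚ‿inverseˡ P = coeffwise lhs (λ i → ≡ₘ-reflexive (ℤP.+-inverseˡ (coeff P i))) (λ _ → refl)
    where
    lhs : ∀ i → coeff (-ₚ P +ₚ P) i ≡ - coeff P i + coeff P i
    lhs i = ≡.trans (coeff-+ₚ (-ₚ P) P i) (cong (_+ coeff P i) (coeff-negₚ P i))

  -ₚ‿inverseʳ : ∀ P → P +ₚ -ₚ P ≈ []
  -ₚ‿inverseʳ P = ≈-trans (+ₚ-comm P (-ₚ P)) (-ₚ‿inverseˡ P)

  scale-cong : ∀ {a b P Q} → a ≡ₘ b → P ≈ Q → scale a P ≈ scale b Q
  scale-cong {a} {b} {P} {Q} e f = coeffwise (coeff-scale a P) (λ i → *-cong-≡ₘ e (at f i)) (coeff-scale b Q)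

  scale-+ₚ : ∀ a P Q → scale a (P +ₚ Q) ≈ scale a P +ₚ scale a Q
  scale-+ₚ a P Q = coeffwise lhs (λ i → ≡ₘ-reflexive (ℤP.*-distribˡ-+ a (coeff P i) (coeff Q i))) rhs
    where
    lhs : ∀ i → coeff (scale a (P +ₚ Q)) i ≡ a * (coeff P i + coeff Q i)
    lhs i = ≡.trans (coeff-scale a (P +ₚ Q) i) (cong (a *_) (coeff-+ₚ P Q i))
    rhs : ∀ i → coeff (scale a P +ₚ scale a Q) i ≡ a * coeff P i + a * coeff Q i
    rhs i = ≡.trans (coeff-+ₚ (scale a P) (scale a Q) i) (cong₂ _+_ (coeff-scale a P i) (coeff-scale a Q i))

  +-scale : ∀ a b Q → scale (a + b) Q ≈ scale a Q +ₚ scale b Q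
  +-scale a b Q = coeffwise (coeff-scale (a + b) Q) (λ i → ≡ₘ-reflexive (ℤP.*-distribʳ-+ (coeff Q i) a b)) rhs
    where
    rhs : ∀ i → coeff (scale a Q +ₚ scale b Q) i ≡ a * coeff Q i + b * coeff Q i
    rhs i = ≡.trans (coeff-+ₚ (scale a Q) (scale b Q) i) (cong₂ _+_ (coeff-scale a Q i) (coeff-scale b Q i))

  *-scale : ∀ a b Q → scale (a * b) Q ≈ scale a (scale b Q)
  *-scale a b Q = coeffwise (coeff-scale (a * b) Q) (λ i → ≡ₘ-reflexive (ℤP.*-assoc a b (coeff Q i))) rhs
    where
    rhs : ∀ i → coeff (scale a (scale b Q)) i ≡ a * (b * coeff Q i)
    rhs i = ≡.trans (coeff-scale a (scale b Q) i) (cong (a *_) (coeff-scale b Q i))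

  scale-zero : ∀ {a} Q → a ≡ₘ + 0 → scale a Q ≈ []
  scale-zero {a} Q a≡0 = coeffwise (coeff-scale a Q)
    (λ i → ≡ₘ-trans (*-cong-≡ₘ a≡0 ≡ₘ-refl) (≡ₘ-reflexive (ℤP.*-zeroˡ (coeff Q i)))) (λ _ → refl)

  scale-one : ∀ Q → scale (+ 1) Q ≈ Q
  scale-one Q = coeffwise (coeff-scale (+ 1) Q) (λ i → ≡ₘ-reflexive (ℤP.*-identityˡ (coeff Q i))) (λ _ → refl)

  shift-cong : ∀ {P Q} → P ≈ Q → shift P ≈ shift Q
  shift-cong e = pointwise λ { zero → ≡ₘ-refl ; (suc i) → at e i }

  shift-[] : shift [] ≈ []
  shift-[] = pointwise λ { zero → ≡ₘ-refl ; (suc i) → ≡ₘ-refl }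

  scale-shift : ∀ a P → scale a (shift P) ≈ shift (scale a P)
  scale-shift a P = pointwise λ { zero → ≡ₘ-reflexive (ℤP.*-zeroʳ a) ; (suc i) → ≡ₘ-refl }

  tail-cong : ∀ {a b P Q} → a ∷ P ≈ b ∷ Q → P ≈ Q
  tail-cong e = pointwise λ i → at e (suc i)

  +ₚ-interchange : ∀ A B C D → (A +ₚ B) +ₚ (C +ₚ D) ≈ (A +ₚ C) +ₚ (B +ₚ D)
  +ₚ-interchange A B C D = coeffwise (sum A B C D) (λ i → ≡ₘ-reflexive (swap (coeff A i) (coeff B i) (coeff C i) (coeff D i))) (sum A C B D)
    where
    sum : ∀ A B C D i → coeff ((A +ₚ B) +ₚ (C +ₚ D)) i ≡ (coeff A i + coeff B i) + (coeff C i + coeff D i)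
    sum A B C D i = ≡.trans (coeff-+ₚ (A +ₚ B) (C +ₚ D) i) (cong₂ _+_ (coeff-+ₚ A B i) (coeff-+ₚ C D i))
    swap : ∀ a b c d → (a + b) + (c + d) ≡ (a + c) + (b + d)
    swap = solve-∀

  *ₚ-zeroˡ : ∀ P Q → P ≈ [] → P *ₚ Q ≈ []
  *ₚ-zeroˡ []      Q e = ≈-refl
  *ₚ-zeroˡ (a ∷ P) Q e = ≈-trans (+ₚ-cong (scale-zero Q (at e 0)) (shift-cong (*ₚ-zeroˡ P Q (pointwise (at e ∘ suc))))) shift-[]

  *ₚ-congʳ : ∀ Q {P P'} → P ≈ P' → P *ₚ Q ≈ P' *ₚ Q
  *ₚ-congʳ Q {[]}    {[]}     e = ≈-refl
  *ₚ-congʳ Q {[]}    {b ∷ P'} e = ≈-sym (*ₚ-zeroˡ (b ∷ P') Q (≈-sym e))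
  *ₚ-congʳ Q {a ∷ P} {[]}     e = *ₚ-zeroˡ (a ∷ P) Q e
  *ₚ-congʳ Q {a ∷ P} {b ∷ P'} e = +ₚ-cong (scale-cong (at e 0) (≈-refl {Q})) (shift-cong (*ₚ-congʳ Q (tail-cong e)))

  *ₚ-congˡ : ∀ P {Q Q'} → Q ≈ Q' → P *ₚ Q ≈ P *ₚ Q'
  *ₚ-congˡ []      e = ≈-refl
  *ₚ-congˡ (a ∷ P) e = +ₚ-cong (scale-cong (≡ₘ-refl {a}) e) (shift-cong (*ₚ-congˡ P e))

  *ₚ-cong : ∀ {P P' Q Q'} → P ≈ P' → Q ≈ Q' → P *ₚ Q ≈ P' *ₚ Q'
  *ₚ-cong {P} {P'} {Q} e f = ≈-trans (*ₚ-congʳ Q e) (*ₚ-congˡ P' f)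

  *ₚ-distribʳ : ∀ Q P P' → (P +ₚ P') *ₚ Q ≈ P *ₚ Q +ₚ P' *ₚ Q
  *ₚ-distribʳ Q []      P'       = ≈-refl
  *ₚ-distribʳ Q (a ∷ P) []       = ≈-sym (+ₚ-identityʳ _)
  *ₚ-distribʳ Q (a ∷ P) (b ∷ P') = begin
    scale (a + b) Q +ₚ shift ((P +ₚ P') *ₚ Q)
      ≈⟨ +ₚ-cong (+-scale a b Q) (shift-cong (*ₚ-distribʳ Q P P')) ⟩
    (scale a Q +ₚ scale b Q) +ₚ (shift (P *ₚ Q) +ₚ shift (P' *ₚ Q))
      ≈⟨ +ₚ-interchange (scale a Q) (scale b Q) (shift (P *ₚ Q)) (shift (P' *ₚ Q)) ⟩
    (scale a Q +ₚ shift (P *ₚ Q)) +ₚ (scale b Q +ₚ shift (P' *ₚ Q)) ∎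
    where open ≈-Reasoning

  *ₚ-distribˡ : ∀ P Q Q' → P *ₚ (Q +ₚ Q') ≈ P *ₚ Q +ₚ P *ₚ Q'
  *ₚ-distribˡ []      Q Q' = ≈-refl
  *ₚ-distribˡ (a ∷ P) Q Q' = begin
    scale a (Q +ₚ Q') +ₚ shift (P *ₚ (Q +ₚ Q'))
      ≈⟨ +ₚ-cong (scale-+ₚ a Q Q') (shift-cong (*ₚ-distribˡ P Q Q')) ⟩
    (scale a Q +ₚ scale a Q') +ₚ (shift (P *ₚ Q) +ₚ shift (P *ₚ Q'))
      ≈⟨ +ₚ-interchange (scale a Q) (scale a Q') (shift (P *ₚ Q)) (shift (P *ₚ Q')) ⟩
    (scale a Q +ₚ shift (P *ₚ Q)) +ₚ (scale a Q' +ₚ shift (P *ₚ Q')) ∎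
    where open ≈-Reasoning

  scale-*ₚ : ∀ a P Q → scale a P *ₚ Q ≈ scale a (P *ₚ Q)
  scale-*ₚ a []      Q = ≈-refl
  scale-*ₚ a (b ∷ P) Q = begin
    scale (a * b) Q +ₚ shift (scale a P *ₚ Q)
      ≈⟨ +ₚ-cong (*-scale a b Q) (≈-trans (shift-cong (scale-*ₚ a P Q)) (≈-sym (scale-shift a (P *ₚ Q)))) ⟩
    scale a (scale b Q) +ₚ scale a (shift (P *ₚ Q))
      ≈⟨ scale-+ₚ a (scale b Q) (shift (P *ₚ Q)) ⟨
    scale a (scale b Q +ₚ shift (P *ₚ Q)) ∎
    where open ≈-Reasoning

  *ₚ-scale : ∀ a P Q → P *ₚ scale a Q ≈ scale a (P *ₚ Q)
  *ₚ-scale a []      Q = ≈-refl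
  *ₚ-scale a (b ∷ P) Q = begin
    scale b (scale a Q) +ₚ shift (P *ₚ scale a Q)
      ≈⟨ +ₚ-cong scale-comm (≈-trans (shift-cong (*ₚ-scale a P Q)) (≈-sym (scale-shift a (P *ₚ Q)))) ⟩
    scale a (scale b Q) +ₚ scale a (shift (P *ₚ Q))
      ≈⟨ scale-+ₚ a (scale b Q) (shift (P *ₚ Q)) ⟨
    scale a (scale b Q +ₚ shift (P *ₚ Q)) ∎
    where
    open ≈-Reasoning
    scale-comm : scale b (scale a Q) ≈ scale a (scale b Q)
    scale-comm = ≈-trans (≈-sym (*-scale b a Q)) (≈-trans (scale-cong (≡ₘ-reflexive (ℤP.*-comm b a)) (≈-refl {Q})) (*-scale a b Q))

  shift-*ₚ : ∀ P Q → shift P *ₚ Q ≈ shift (P *ₚ Q)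
  shift-*ₚ P Q = +ₚ-congʳ (shift (P *ₚ Q)) (scale-zero Q ≡ₘ-refl)

  *ₚ-shift : ∀ P Q → P *ₚ shift Q ≈ shift (P *ₚ Q)
  *ₚ-shift []      Q = ≈-sym shift-[]
  *ₚ-shift (a ∷ P) Q = +ₚ-cong (scale-shift a Q) (shift-cong (*ₚ-shift P Q))

  *ₚ-assoc : ∀ P Q T → (P *ₚ Q) *ₚ T ≈ P *ₚ (Q *ₚ T)
  *ₚ-assoc []      Q T = ≈-refl
  *ₚ-assoc (a ∷ P) Q T = begin
    (scale a Q +ₚ shift (P *ₚ Q)) *ₚ T        ≈⟨ *ₚ-distribʳ T (scale a Q) (shift (P *ₚ Q)) ⟩
    scale a Q *ₚ T +ₚ shift (P *ₚ Q) *ₚ T     ≈⟨ +ₚ-cong (scale-*ₚ a Q T) (≈-trans (shift-*ₚ (P *ₚ Q) T) (shift-cong (*ₚ-assoc P Q T))) ⟩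
    scale a (Q *ₚ T) +ₚ shift (P *ₚ (Q *ₚ T)) ∎
    where open ≈-Reasoning

  *ₚ-zeroʳ : ∀ P → P *ₚ [] ≈ []
  *ₚ-zeroʳ []      = ≈-refl
  *ₚ-zeroʳ (a ∷ P) = ≈-trans (shift-cong (*ₚ-zeroʳ P)) shift-[]

  scale-oneₚ : ∀ a P → a ∷ P ≈ scale a oneₚ +ₚ shift P
  scale-oneₚ a P = pointwise λ { zero → ≡ₘ-reflexive (≡.sym (≡.trans (ℤP.+-identityʳ (a * + 1)) (ℤP.*-identityʳ a))) ; (suc i) → ≡ₘ-refl }

  *ₚ-identityʳ : ∀ P → P *ₚ oneₚ ≈ P
  *ₚ-identityʳ []      = ≈-refl
  *ₚ-identityʳ (a ∷ P) = ≈-trans (+ₚ-congˡ (scale a oneₚ) (shift-cong (*ₚ-identityʳ P))) (≈-sym (scale-oneₚ a P))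

  *ₚ-identityˡ : ∀ P → oneₚ *ₚ P ≈ P
  *ₚ-identityˡ P = ≈-trans (+ₚ-cong (scale-one P) shift-[]) (+ₚ-identityʳ P)

  *ₚ-comm : ∀ P Q → P *ₚ Q ≈ Q *ₚ P
  *ₚ-comm []      Q = ≈-sym (*ₚ-zeroʳ Q)
  *ₚ-comm (a ∷ P) Q = ≈-sym (begin
    Q *ₚ (a ∷ P)                              ≈⟨ *ₚ-congˡ Q (scale-oneₚ a P) ⟩
    Q *ₚ (scale a oneₚ +ₚ shift P)             ≈⟨ *ₚ-distribˡ Q (scale a oneₚ) (shift P) ⟩
    Q *ₚ scale a oneₚ +ₚ Q *ₚ shift P          ≈⟨ +ₚ-cong (≈-trans (*ₚ-scale a Q oneₚ) (scale-cong (≡ₘ-refl {a}) (*ₚ-identityʳ Q)))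
                                                         (≈-trans (*ₚ-shift Q P) (shift-cong (*ₚ-comm Q P))) ⟩
    scale a Q +ₚ shift (P *ₚ Q)                ∎)
    where open ≈-Reasoning

  poly-ring : CommutativeRing _ _
  poly-ring = record
    { Carrier = Poly ; _≈_ = _≈_ ; _+_ = _+ₚ_ ; _*_ = _*ₚ_ ; -_ = -ₚ_ ; 0# = [] ; 1# = oneₚ
    ; isCommutativeRing = record
      { isRing = record
        { +-isAbelianGroup = record
          { isGroup = record
            { isMonoid = record
              { isSemigroup = record
                { isMagma = record { isEquivalence = Setoid.isEquivalence poly-setoid ; ∙-cong = +ₚ-cong }
                ; assoc = +ₚ-assoc }
              ; identity = (λ _ → ≈-refl) , +ₚ-identityʳ }
            ; inverse = -ₚ‿inverseˡ , -ₚ‿inverseʳ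
            ; ⁻¹-cong = -ₚ-cong }
          ; comm = +ₚ-comm }
        ; *-cong = *ₚ-cong
        ; *-assoc = *ₚ-assoc
        ; *-identity = *ₚ-identityˡ , *ₚ-identityʳ
        ; distrib = *ₚ-distribˡ , *ₚ-distribʳ }
      ; *-comm = *ₚ-comm } }

  poly-almostRing : AlmostCommutativeRing _ _
  poly-almostRing = fromCommutativeRing poly-ring (λ _ → nothing)

  open import Algebra.Properties.Ring (CommutativeRing.ring poly-ring) public using (-1*x≈-x; -‿distribʳ-*)
  open import Algebra.Properties.AbelianGroup (CommutativeRing.+-abelianGroup poly-ring) public using (xyx⁻¹≈y; //-rightDividesˡ; inverseˡ-unique)

  -- The formal derivative

  constₚ : ℤ → Poly
  constₚ a = a ∷ []

  scale≈constₚ-*ₚ : ∀ a T → scale a T ≈ constₚ a *ₚ T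
  scale≈constₚ-*ₚ a T = ≈-sym (≈-trans (+ₚ-congˡ (scale a T) shift-[]) (+ₚ-identityʳ (scale a T)))

  shift≈X*ₚ : ∀ T → shift T ≈ Xpow 1 *ₚ T
  shift≈X*ₚ T = ≈-sym (+ₚ-cong (scale-zero T ≡ₘ-refl) (shift-cong (*ₚ-identityˡ T)))

  coeff-derivFrom : ∀ k P i → coeff (derivFrom k P) i ≡ + (k ℕ.+ i) * coeff P i
  coeff-derivFrom k []      i       = ≡.sym (ℤP.*-zeroʳ (+ (k ℕ.+ i)))
  coeff-derivFrom k (b ∷ P) zero    = cong (λ n → + n * b) (≡.sym (ℕP.+-identityʳ k))
  coeff-derivFrom k (b ∷ P) (suc i) = ≡.trans (coeff-derivFrom (suc k) P i) (cong (λ n → + n * coeff P i) (≡.sym (ℕP.+-suc k i)))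

  coeff-deriv : ∀ P i → coeff (deriv P) i ≡ + suc i * coeff P (suc i)
  coeff-deriv []      i = ≡.sym (ℤP.*-zeroʳ (+ suc i))
  coeff-deriv (a ∷ P) i = coeff-derivFrom 1 P i

  deriv-+ₚ : ∀ P Q → deriv (P +ₚ Q) ≈ deriv P +ₚ deriv Q
  deriv-+ₚ P Q = coeffwise lhs (λ i → ≡ₘ-reflexive (ℤP.*-distribˡ-+ (+ suc i) (coeff P (suc i)) (coeff Q (suc i)))) rhs
    where
    lhs : ∀ i → coeff (deriv (P +ₚ Q)) i ≡ + suc i * (coeff P (suc i) + coeff Q (suc i))
    lhs i = ≡.trans (coeff-deriv (P +ₚ Q) i) (cong (+ suc i *_) (coeff-+ₚ P Q (suc i)))
    rhs : ∀ i → coeff (deriv P +ₚ deriv Q) i ≡ + suc i * coeff P (suc i) + + suc i * coeff Q (suc i)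
    rhs i = ≡.trans (coeff-+ₚ (deriv P) (deriv Q) i) (cong₂ _+_ (coeff-deriv P i) (coeff-deriv Q i))

  deriv-scale : ∀ a P → deriv (scale a P) ≈ scale a (deriv P)
  deriv-scale a P = coeffwise lhs (λ i → ≡ₘ-reflexive (swap (+ suc i) a (coeff P (suc i)))) rhs
    where
    lhs : ∀ i → coeff (deriv (scale a P)) i ≡ + suc i * (a * coeff P (suc i))
    lhs i = ≡.trans (coeff-deriv (scale a P) i) (cong (+ suc i *_) (coeff-scale a P (suc i)))
    rhs : ∀ i → coeff (scale a (deriv P)) i ≡ a * (+ suc i * coeff P (suc i))
    rhs i = ≡.trans (coeff-scale a (deriv P) i) (cong (a *_) (coeff-deriv P i))
    swap : ∀ n a x → n * (a * x) ≡ a * (n * x)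
    swap = solve-∀

  deriv-∷ : ∀ a P → deriv (a ∷ P) ≈ P +ₚ shift (deriv P)
  deriv-∷ a P = pointwise λ
    { zero    → ≡ₘ-reflexive (begin
        coeff (deriv (a ∷ P)) 0         ≡⟨ coeff-deriv (a ∷ P) 0 ⟩
        + 1 * coeff P 0                 ≡⟨ ℤP.*-identityˡ (coeff P 0) ⟩
        coeff P 0                       ≡⟨ ℤP.+-identityʳ (coeff P 0) ⟨
        coeff P 0 + + 0                 ≡⟨ coeff-+ₚ P (shift (deriv P)) 0 ⟨
        coeff (P +ₚ shift (deriv P)) 0  ∎)
    ; (suc i) → ≡ₘ-reflexive (begin
        coeff (deriv (a ∷ P)) (suc i)                 ≡⟨ coeff-deriv (a ∷ P) (suc i) ⟩
        (+ 1 + + suc i) * coeff P (suc i)             ≡⟨ ℤP.*-distribʳ-+ (coeff P (suc i)) (+ 1) (+ suc i) ⟩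
        + 1 * coeff P (suc i) + + suc i * coeff P (suc i)
          ≡⟨ cong₂ _+_ (ℤP.*-identityˡ (coeff P (suc i))) (≡.sym (coeff-deriv P i)) ⟩
        coeff P (suc i) + coeff (deriv P) i           ≡⟨ coeff-+ₚ P (shift (deriv P)) (suc i) ⟨
        coeff (P +ₚ shift (deriv P)) (suc i)          ∎) }
    where open ≡.≡-Reasoning

  deriv-*ₚ : ∀ P Q → deriv (P *ₚ Q) ≈ deriv P *ₚ Q +ₚ P *ₚ deriv Q
  deriv-*ₚ []      Q = ≈-refl
  deriv-*ₚ (a ∷ P) Q = begin
    deriv (scale a Q +ₚ shift (P *ₚ Q))
      ≈⟨ deriv-+ₚ (scale a Q) (shift (P *ₚ Q)) ⟩
    deriv (scale a Q) +ₚ deriv (shift (P *ₚ Q))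
      ≈⟨ +ₚ-cong (≈-trans (deriv-scale a Q) (scale≈constₚ-*ₚ a (deriv Q)))
                 (≈-trans (deriv-∷ (+ 0) (P *ₚ Q)) (+ₚ-congˡ (P *ₚ Q) (≈-trans (shift≈X*ₚ _) (*ₚ-congˡ (Xpow 1) (deriv-*ₚ P Q))))) ⟩
    constₚ a *ₚ deriv Q +ₚ (P *ₚ Q +ₚ Xpow 1 *ₚ (deriv P *ₚ Q +ₚ P *ₚ deriv Q))
      ≈⟨ regroup (constₚ a) (deriv Q) P Q (Xpow 1) (deriv P) ⟩
    (P +ₚ Xpow 1 *ₚ deriv P) *ₚ Q +ₚ (constₚ a *ₚ deriv Q +ₚ Xpow 1 *ₚ (P *ₚ deriv Q))
      ≈⟨ +ₚ-cong (*ₚ-congʳ Q (≈-trans (deriv-∷ a P) (+ₚ-congˡ P (shift≈X*ₚ (deriv P)))))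
                 (+ₚ-cong (scale≈constₚ-*ₚ a (deriv Q)) (shift≈X*ₚ (P *ₚ deriv Q))) ⟨
    deriv (a ∷ P) *ₚ Q +ₚ (scale a (deriv Q) +ₚ shift (P *ₚ deriv Q)) ∎
    where
    open ≈-Reasoning
    regroup : ∀ A DQ P Q X DP → A *ₚ DQ +ₚ (P *ₚ Q +ₚ X *ₚ (DP *ₚ Q +ₚ P *ₚ DQ))
                              ≈ (P +ₚ X *ₚ DP) *ₚ Q +ₚ (A *ₚ DQ +ₚ X *ₚ (P *ₚ DQ))
    regroup = RingSolver.solve-∀ poly-almostRing

  deriv-^ₚ : ∀ R k → deriv (R ^ₚ suc k) ≈ constₚ (+ suc k) *ₚ (deriv R *ₚ R ^ₚ k)
  deriv-^ₚ R zero = begin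
    deriv (R *ₚ oneₚ)            ≈⟨ deriv-*ₚ R oneₚ ⟩
    deriv R *ₚ oneₚ +ₚ R *ₚ []   ≈⟨ +ₚ-congˡ (deriv R *ₚ oneₚ) (*ₚ-zeroʳ R) ⟩
    deriv R *ₚ oneₚ +ₚ []        ≈⟨ +ₚ-identityʳ _ ⟩
    deriv R *ₚ oneₚ              ≈⟨ *ₚ-identityˡ _ ⟨
    oneₚ *ₚ (deriv R *ₚ oneₚ)    ∎
    where open ≈-Reasoning
  -- oneₚ +ₚ constₚ (+ suc k) computes to constₚ (+ suc (suc k)).
  deriv-^ₚ R (suc k) = begin
    deriv (R *ₚ R ^ₚ suc k)                                       ≈⟨ deriv-*ₚ R (R ^ₚ suc k) ⟩
    deriv R *ₚ R ^ₚ suc k +ₚ R *ₚ deriv (R ^ₚ suc k)              ≈⟨ +ₚ-congˡ (deriv R *ₚ R ^ₚ suc k) (*ₚ-congˡ R (deriv-^ₚ R k)) ⟩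
    deriv R *ₚ (R *ₚ R ^ₚ k) +ₚ R *ₚ (constₚ (+ suc k) *ₚ (deriv R *ₚ R ^ₚ k))
                                                                  ≈⟨ collect (deriv R) R (R ^ₚ k) (constₚ (+ suc k)) ⟩
    (oneₚ +ₚ constₚ (+ suc k)) *ₚ (deriv R *ₚ (R *ₚ R ^ₚ k))      ∎
    where
    open ≈-Reasoning
    collect : ∀ DR R Rk C → DR *ₚ (R *ₚ Rk) +ₚ R *ₚ (C *ₚ (DR *ₚ Rk)) ≈ (oneₚ +ₚ C) *ₚ (DR *ₚ (R *ₚ Rk))
    collect = RingSolver.solve-∀ poly-almostRing

  derivCofactor : ℤ → Poly → Poly → Poly
  derivCofactor c R S = constₚ c *ₚ (deriv R *ₚ S) +ₚ R *ₚ deriv S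

  deriv-^ₚ-*ₚ : ∀ R S k → deriv (R ^ₚ suc k *ₚ S) ≈ R ^ₚ k *ₚ derivCofactor (+ suc k) R S
  deriv-^ₚ-*ₚ R S k = begin
    deriv (R ^ₚ suc k *ₚ S)
      ≈⟨ deriv-*ₚ (R ^ₚ suc k) S ⟩
    deriv (R ^ₚ suc k) *ₚ S +ₚ (R *ₚ R ^ₚ k) *ₚ deriv S
      ≈⟨ +ₚ-congʳ _ (*ₚ-congʳ S (deriv-^ₚ R k)) ⟩
    (constₚ (+ suc k) *ₚ (deriv R *ₚ R ^ₚ k)) *ₚ S +ₚ (R *ₚ R ^ₚ k) *ₚ deriv S
      ≈⟨ factor (constₚ (+ suc k)) (deriv R) (R ^ₚ k) R S (deriv S) ⟩
    R ^ₚ k *ₚ (constₚ (+ suc k) *ₚ (deriv R *ₚ S) +ₚ R *ₚ deriv S) ∎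
    where
    open ≈-Reasoning
    factor : ∀ C DR Rk R S DS → (C *ₚ (DR *ₚ Rk)) *ₚ S +ₚ (R *ₚ Rk) *ₚ DS ≈ Rk *ₚ (C *ₚ (DR *ₚ S) +ₚ R *ₚ DS)
    factor = RingSolver.solve-∀ poly-almostRing

  deriv--ₚ-oneₚ : ∀ F → deriv (F -ₚ oneₚ) ≈ deriv F
  deriv--ₚ-oneₚ F = ≈-trans (deriv-+ₚ F (-ₚ oneₚ)) (+ₚ-identityʳ (deriv F))

  -- Order of vanishing at 0 and degree bounds

  VanishesBelow : ℕ → Poly → Set
  VanishesBelow n P = ∀ i → i ℕ.< n → coeff P i ≡ₘ + 0

  DegreeBelow : ℕ → Poly → Set
  DegreeBelow n P = ∀ i → n ℕ.≤ i → coeff P i ≡ₘ + 0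

  vanishesBelow-cong : ∀ {n P Q} → P ≈ Q → VanishesBelow n P → VanishesBelow n Q
  vanishesBelow-cong e h i i<n = ≡ₘ-trans (≡ₘ-sym (at e i)) (h i i<n)

  degreeBelow-cong : ∀ {n P Q} → P ≈ Q → DegreeBelow n P → DegreeBelow n Q
  degreeBelow-cong e h i n≤i = ≡ₘ-trans (≡ₘ-sym (at e i)) (h i n≤i)

  vanishesBelow∧degreeBelow⇒≈[] : ∀ n {P} → VanishesBelow n P → DegreeBelow n P → P ≈ []
  vanishesBelow∧degreeBelow⇒≈[] n {P} low high = pointwise coeff≡0
    where
    coeff≡0 : ∀ i → coeff P i ≡ₘ + 0
    coeff≡0 i with i ℕ.<? n
    ... | yes i<n = low i i<n
    ... | no  i≮n = high i (ℕP.≮⇒≥ i≮n)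

  Xpow-*ₚ-vanishesBelow : ∀ n Q → VanishesBelow n (Xpow n *ₚ Q)
  Xpow-*ₚ-vanishesBelow (suc n) Q zero    _         = at (shift-*ₚ (Xpow n) Q) 0
  Xpow-*ₚ-vanishesBelow (suc n) Q (suc i) (s≤s i<n) = ≡ₘ-trans (at (shift-*ₚ (Xpow n) Q) (suc i)) (Xpow-*ₚ-vanishesBelow n Q i i<n)

  coeff-Xpow-*ₚ : ∀ j B t → coeff (Xpow j *ₚ B) (j ℕ.+ t) ≡ₘ coeff B t
  coeff-Xpow-*ₚ zero    B t = at (*ₚ-identityˡ B) t
  coeff-Xpow-*ₚ (suc j) B t = ≡ₘ-trans (at (shift-*ₚ (Xpow j) B) (suc (j ℕ.+ t))) (coeff-Xpow-*ₚ j B t)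

  coeff-deriv≡ₘ0 : ∀ P i → coeff P (suc i) ≡ₘ + 0 → coeff (deriv P) i ≡ₘ + 0
  coeff-deriv≡ₘ0 P i h = ≡ₘ-trans (≡ₘ-reflexive (coeff-deriv P i))
    (≡ₘ-trans (*-cong-≡ₘ (≡ₘ-refl {+ suc i}) h) (≡ₘ-reflexive (ℤP.*-zeroʳ (+ suc i))))

  deriv-vanishesBelow : ∀ n P → VanishesBelow (suc n) P → VanishesBelow n (deriv P)
  deriv-vanishesBelow n P h i i<n = coeff-deriv≡ₘ0 P i (h (suc i) (s≤s i<n))

  deriv-degreeBelow : ∀ n P → DegreeBelow (suc n) P → DegreeBelow n (deriv P)
  deriv-degreeBelow n P h i n≤i = coeff-deriv≡ₘ0 P i (h (suc i) (s≤s n≤i))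

  coeff₀-*ₚ : ∀ P Q → coeff (P *ₚ Q) 0 ≡ coeff P 0 * coeff Q 0
  coeff₀-*ₚ []      Q = ≡.sym (ℤP.*-zeroˡ (coeff Q 0))
  coeff₀-*ₚ (a ∷ P) Q = begin
    coeff (scale a Q +ₚ shift (P *ₚ Q)) 0   ≡⟨ coeff-+ₚ (scale a Q) (shift (P *ₚ Q)) 0 ⟩
    coeff (scale a Q) 0 + + 0               ≡⟨ ℤP.+-identityʳ _ ⟩
    coeff (scale a Q) 0                     ≡⟨ coeff-scale a Q 0 ⟩
    a * coeff Q 0                           ∎
    where open ≡.≡-Reasoning

  coeff₀-^ₚ : ∀ R k → coeff R 0 ≡ₘ + 1 → coeff (R ^ₚ k) 0 ≡ₘ + 1
  coeff₀-^ₚ R zero    R₀≡1 = ≡ₘ-refl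
  coeff₀-^ₚ R (suc k) R₀≡1 = ≡ₘ-trans (≡ₘ-reflexive (coeff₀-*ₚ R (R ^ₚ k))) (*-cong-≡ₘ R₀≡1 (coeff₀-^ₚ R k R₀≡1))

  -- A constant term equal to 1 makes A invertible modulo every power of x.
  vanishesBelow-cancelˡ : ∀ A → coeff A 0 ≡ₘ + 1 → ∀ k W → VanishesBelow k (A *ₚ W) → VanishesBelow k W
  vanishesBelow-cancelˡ A A₀≡1 (suc k) []      h i       _         = ≡ₘ-refl
  vanishesBelow-cancelˡ A A₀≡1 (suc k) (w ∷ W) h = λ where
      zero    _         → w≡0
      (suc i) (s≤s i<k) → vanishesBelow-cancelˡ A A₀≡1 k W A*W-low i i<k
    where
    w≡0 : w ≡ₘ + 0
    w≡0 = begin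
      w                             ≡⟨ ℤP.*-identityˡ w ⟨
      + 1 * w                       ≈⟨ *-cong-≡ₘ A₀≡1 ≡ₘ-refl ⟨
      coeff A 0 * w                 ≡⟨ coeff₀-*ₚ A (w ∷ W) ⟨
      coeff (A *ₚ (w ∷ W)) 0        ≈⟨ h 0 (s≤s z≤n) ⟩
      + 0                           ∎
      where open ≡ₘ-Reasoning
    shifted : A *ₚ (w ∷ W) ≈ shift (A *ₚ W)
    shifted = begin
      A *ₚ (w ∷ W)                  ≈⟨ *ₚ-comm A (w ∷ W) ⟩
      scale w A +ₚ shift (W *ₚ A)   ≈⟨ +ₚ-cong (scale-zero A w≡0) (shift-cong (*ₚ-comm W A)) ⟩
      shift (A *ₚ W)                ∎
      where open ≈-Reasoning
    A*W-low : VanishesBelow k (A *ₚ W)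
    A*W-low j j<k = ≡ₘ-trans (at (≈-sym shifted) (suc j)) (h (suc j) (s≤s j<k))

  degreeBelow-mono : ∀ {m n P} → m ℕ.≤ n → DegreeBelow m P → DegreeBelow n P
  degreeBelow-mono m≤n h i n≤i = h i (ℕP.≤-trans m≤n n≤i)

  degreeBelow-+ₚ : ∀ {n} P Q → DegreeBelow n P → DegreeBelow n Q → DegreeBelow n (P +ₚ Q)
  degreeBelow-+ₚ P Q h g i n≤i = ≡ₘ-trans (≡ₘ-reflexive (coeff-+ₚ P Q i)) (+-cong-≡ₘ (h i n≤i) (g i n≤i))

  degreeBelow-scale : ∀ {n} a P → DegreeBelow n P → DegreeBelow n (scale a P)
  degreeBelow-scale a P h i n≤i =
    ≡ₘ-trans (≡ₘ-reflexive (coeff-scale a P i)) (≡ₘ-trans (*-cong-≡ₘ (≡ₘ-refl {a}) (h i n≤i)) (≡ₘ-reflexive (ℤP.*-zeroʳ a)))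

  degreeBelow-shift : ∀ {n} P → DegreeBelow n P → DegreeBelow (suc n) (shift P)
  degreeBelow-shift P h (suc i) (s≤s n≤i) = h i n≤i

  degreeBelow-length : ∀ A → DegreeBelow (length A) A
  degreeBelow-length []      i       _         = ≡ₘ-refl
  degreeBelow-length (a ∷ A) (suc i) (s≤s n≤i) = degreeBelow-length A i n≤i

  degreeBelow-0⇒≈[] : ∀ {P} → DegreeBelow 0 P → P ≈ []
  degreeBelow-0⇒≈[] h = pointwise λ i → h i z≤n

  degreeBelow-*ₚ : ∀ a b P Q → DegreeBelow a P → DegreeBelow (suc b) Q → DegreeBelow (a ℕ.+ b) (P *ₚ Q)
  degreeBelow-*ₚ a       b []      Q h g i _ = ≡ₘ-refl
  degreeBelow-*ₚ zero    b (c ∷ P) Q h g   = degreeBelow-cong (≈-sym (*ₚ-zeroˡ (c ∷ P) Q (degreeBelow-0⇒≈[] h))) (λ _ _ → ≡ₘ-refl)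
  degreeBelow-*ₚ (suc a) b (c ∷ P) Q h g   = degreeBelow-+ₚ (scale c Q) (shift (P *ₚ Q))
    (degreeBelow-mono {P = scale c Q} (s≤s (ℕP.m≤n+m b a)) (degreeBelow-scale c Q g))
    (degreeBelow-shift (P *ₚ Q) (degreeBelow-*ₚ a b P Q (λ i a≤i → h (suc i) (s≤s a≤i)) g))

  hasDegree⇒degreeBelow : ∀ P {d} → HasDegree p P d → DegreeBelow (suc d) P
  hasDegree⇒degreeBelow P (_ , above) i d<i = mk (above i d<i)

  degreeBelow-constₚ-*ₚ : ∀ {n} c P → DegreeBelow n P → DegreeBelow n (constₚ c *ₚ P)
  degreeBelow-constₚ-*ₚ c P h = degreeBelow-cong (scale≈constₚ-*ₚ c P) (degreeBelow-scale c P h)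

  degreeBelow-derivCofactor : ∀ {a b} c R S → DegreeBelow (suc a) R → DegreeBelow (suc b) S
                            → DegreeBelow (a ℕ.+ b) (derivCofactor c R S)
  degreeBelow-derivCofactor {a} {b} c R S R<a+1 S<b+1 = degreeBelow-+ₚ (constₚ c *ₚ (deriv R *ₚ S)) (R *ₚ deriv S)
    (degreeBelow-constₚ-*ₚ c (deriv R *ₚ S) (degreeBelow-*ₚ a b (deriv R) S (deriv-degreeBelow a R R<a+1) S<b+1))
    (≡.subst (λ n → DegreeBelow n (R *ₚ deriv S)) (ℕP.+-comm b a)
      (degreeBelow-cong (*ₚ-comm (deriv S) R) (degreeBelow-*ₚ b a (deriv S) R (deriv-degreeBelow b S S<b+1) R<a+1)))

  Xpow∣R^mS-1⇒derivCofactor≈[] : ∀ {a b} R S k Q → coeff R 0 ≡ₘ + 1 → DegreeBelow (suc a) R → DegreeBelow (suc b) S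
                            → Xpow (a ℕ.+ b ℕ.+ 1) *ₚ Q ≈ R ^ₚ suc k *ₚ S -ₚ oneₚ → derivCofactor (+ suc k) R S ≈ []
  Xpow∣R^mS-1⇒derivCofactor≈[] {a} {b} R S k Q R₀≡1 R<a+1 S<b+1 XQ≈F-1 =
    vanishesBelow∧degreeBelow⇒≈[] n W-low (degreeBelow-derivCofactor (+ suc k) R S R<a+1 S<b+1)
    where
    n = a ℕ.+ b
    F = R ^ₚ suc k *ₚ S
    F-1-low : VanishesBelow (suc n) (F -ₚ oneₚ)
    F-1-low = ≡.subst (λ N → VanishesBelow N (F -ₚ oneₚ)) (ℕP.+-comm n 1)
      (vanishesBelow-cong XQ≈F-1 (Xpow-*ₚ-vanishesBelow (n ℕ.+ 1) Q))
    W-low : VanishesBelow n (derivCofactor (+ suc k) R S)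
    W-low = vanishesBelow-cancelˡ (R ^ₚ k) (coeff₀-^ₚ R k R₀≡1) n (derivCofactor (+ suc k) R S)
      (vanishesBelow-cong (≈-trans (deriv--ₚ-oneₚ F) (deriv-^ₚ-*ₚ R S k)) (deriv-vanishesBelow n (F -ₚ oneₚ) F-1-low))

  -- Divisibility and long division

  coeff--ₚ : ∀ P Q i → coeff (P -ₚ Q) i ≡ coeff P i - coeff Q i
  coeff--ₚ P Q i = ≡.trans (coeff-+ₚ P (-ₚ Q) i) (cong (_+_ (coeff P i)) (coeff-negₚ Q i))

  coeff-constₚ-*ₚ : ∀ c T i → coeff (constₚ c *ₚ T) i ≡ₘ c * coeff T i
  coeff-constₚ-*ₚ c T i = ≡ₘ-trans (at (≈-sym (scale≈constₚ-*ₚ c T)) i) (≡ₘ-reflexive (coeff-scale c T i))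

  constₚ-cong : ∀ {a b} → a ≡ₘ b → constₚ a ≈ constₚ b
  constₚ-cong e = pointwise λ { zero → e ; (suc i) → ≡ₘ-refl }

  constₚ-*ₚ : ∀ a b → constₚ a *ₚ constₚ b ≈ constₚ (a * b)
  constₚ-*ₚ a b = pointwise λ
    { zero    → coeff-constₚ-*ₚ a (constₚ b) 0
    ; (suc i) → ≡ₘ-trans (coeff-constₚ-*ₚ a (constₚ b) (suc i)) (≡ₘ-reflexive (ℤP.*-zeroʳ a)) }

  degreeBelow-from : ∀ n P → (∀ e → coeff P (n ℕ.+ e) ≡ₘ + 0) → DegreeBelow n P
  degreeBelow-from n P h i n≤i = ≡.subst (λ j → coeff P j ≡ₘ + 0) (ℕP.m+[n∸m]≡n n≤i) (h (i ℕ.∸ n))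

  infix 4 _∣ₚ_
  record _∣ₚ_ (A B : Poly) : Set where
    constructor divides
    field
      cofactor : Poly
      equality : A *ₚ cofactor ≈ B

  ∣ₚ-refl : ∀ A → A ∣ₚ A
  ∣ₚ-refl A = divides oneₚ (*ₚ-identityʳ A)

  ∣ₚ-respʳ : ∀ {G B B'} → B ≈ B' → G ∣ₚ B → G ∣ₚ B'
  ∣ₚ-respʳ e (divides Q GQ≈B) = divides Q (≈-trans GQ≈B e)

  ∣ₚ-+ₚ : ∀ {G A B} → G ∣ₚ A → G ∣ₚ B → G ∣ₚ A +ₚ B
  ∣ₚ-+ₚ {G} (divides Q GQ≈A) (divides Q' GQ'≈B) = divides (Q +ₚ Q') (≈-trans (*ₚ-distribˡ G Q Q') (+ₚ-cong GQ≈A GQ'≈B))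

  ∣ₚ-*ₚ : ∀ {G A} T → G ∣ₚ A → G ∣ₚ T *ₚ A
  ∣ₚ-*ₚ {G} T (divides Q GQ≈A) = divides (T *ₚ Q) (≈-trans (swap G T Q) (*ₚ-congˡ T GQ≈A))
    where
    swap : ∀ G T Q → G *ₚ (T *ₚ Q) ≈ T *ₚ (G *ₚ Q)
    swap = RingSolver.solve-∀ poly-almostRing

  ∣ₚ⇒∣[p] : ∀ {A B} → A ∣ₚ B → A ∣[ p ] B
  ∣ₚ⇒∣[p] (divides Q e) = Q , λ i → get (at e i)

  bézout∧∣ₚ-*ₚ⇒∣ₚ : ∀ {A B} U V S → oneₚ ≈ U *ₚ A +ₚ V *ₚ B → A ∣ₚ B *ₚ S → A ∣ₚ S
  bézout∧∣ₚ-*ₚ⇒∣ₚ {A} {B} U V S 1≈UA+VB (divides T AT≈BS) = divides (U *ₚ S +ₚ V *ₚ T) (≈-sym (begin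
    S                                      ≈⟨ *ₚ-identityˡ S ⟨
    oneₚ *ₚ S                              ≈⟨ *ₚ-congʳ S 1≈UA+VB ⟩
    (U *ₚ A +ₚ V *ₚ B) *ₚ S                ≈⟨ distribute U A V B S ⟩
    U *ₚ (A *ₚ S) +ₚ V *ₚ (B *ₚ S)         ≈⟨ +ₚ-congˡ (U *ₚ (A *ₚ S)) (*ₚ-congˡ V AT≈BS) ⟨
    U *ₚ (A *ₚ S) +ₚ V *ₚ (A *ₚ T)         ≈⟨ factor U A S V T ⟩
    A *ₚ (U *ₚ S +ₚ V *ₚ T)                ∎))
    where
    open ≈-Reasoning
    distribute : ∀ U A V B S → (U *ₚ A +ₚ V *ₚ B) *ₚ S ≈ U *ₚ (A *ₚ S) +ₚ V *ₚ (B *ₚ S)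
    distribute = RingSolver.solve-∀ poly-almostRing
    factor : ∀ U A S V T → U *ₚ (A *ₚ S) +ₚ V *ₚ (A *ₚ T) ≈ A *ₚ (U *ₚ S +ₚ V *ₚ T)
    factor = RingSolver.solve-∀ poly-almostRing

  reduceDegree : ∀ B k → DegreeBelow (suc k) B → ∀ b' → b' * coeff B k ≡ₘ + 1
               → ∀ L A → k ℕ.≤ L → DegreeBelow (suc L) A
               → DegreeBelow L (A -ₚ constₚ (coeff A L * b') *ₚ (Xpow (L ℕ.∸ k) *ₚ B))
  reduceDegree B k B<k+1 b' b'bₖ≡1 L A k≤L A<L+1 = degreeBelow-from L (A -ₚ Y) λ e → begin
    coeff (A -ₚ Y) (L ℕ.+ e)                     ≡⟨ coeff--ₚ A Y (L ℕ.+ e) ⟩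
    coeff A (L ℕ.+ e) - coeff Y (L ℕ.+ e)         ≈⟨ +-cong-≡ₘ (≡ₘ-refl {coeff A (L ℕ.+ e)}) (neg-cong-≡ₘ (coeff-Y e)) ⟩
    coeff A (L ℕ.+ e) - c * coeff B (k ℕ.+ e)     ≈⟨ top e ⟩
    + 0                                           ∎
    where
    open ≡ₘ-Reasoning
    j = L ℕ.∸ k
    a = coeff A L
    c = a * b'
    Y = constₚ c *ₚ (Xpow j *ₚ B)

    coeff-Y : ∀ e → coeff Y (L ℕ.+ e) ≡ₘ c * coeff B (k ℕ.+ e)
    coeff-Y e = ≡ₘ-trans (coeff-constₚ-*ₚ c (Xpow j *ₚ B) (L ℕ.+ e)) (*-cong-≡ₘ (≡ₘ-refl {c})
      (≡ₘ-trans (≡ₘ-reflexive (cong (coeff (Xpow j *ₚ B)) L+e≡j+[k+e])) (coeff-Xpow-*ₚ j B (k ℕ.+ e))))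
      where
      L+e≡j+[k+e] : L ℕ.+ e ≡ j ℕ.+ (k ℕ.+ e)
      L+e≡j+[k+e] = ≡.trans (cong (ℕ._+ e) (≡.sym (ℕP.m∸n+n≡m k≤L))) (ℕP.+-assoc j k e)

    leading : ∀ {i t} → i ≡ L → t ≡ k → coeff A i - c * coeff B t ≡ₘ + 0
    leading refl refl = begin
      a - a * b' * coeff B k          ≡⟨ factor a b' (coeff B k) ⟩
      a * (+ 1 - b' * coeff B k)      ≈⟨ *-cong-≡ₘ (≡ₘ-refl {a}) (+-cong-≡ₘ (≡ₘ-refl {+ 1}) (neg-cong-≡ₘ b'bₖ≡1)) ⟩
      a * (+ 1 - + 1)                 ≡⟨ ℤP.*-zeroʳ a ⟩
      + 0                             ∎
      where
      factor : ∀ a b' b → a - a * b' * b ≡ a * (+ 1 - b' * b)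
      factor = solve-∀

    top : ∀ e → coeff A (L ℕ.+ e) - c * coeff B (k ℕ.+ e) ≡ₘ + 0
    top zero    = leading (ℕP.+-identityʳ L) (ℕP.+-identityʳ k)
    top (suc e) = ≡ₘ-trans (+-cong-≡ₘ (A<L+1 (L ℕ.+ suc e) (ℕP.m<m+n L (s≤s z≤n)))
                                      (neg-cong-≡ₘ (*-cong-≡ₘ (≡ₘ-refl {c}) (B<k+1 (k ℕ.+ suc e) (ℕP.m<m+n k (s≤s z≤n))))))
                           (≡ₘ-reflexive (zero-difference c))
      where
      zero-difference : ∀ c → + 0 - c * + 0 ≡ + 0
      zero-difference = solve-∀

  record Division (A B : Poly) (k : ℕ) : Set where
    constructor division
    field
      quotient remainder : Poly
      equation : A ≈ quotient *ₚ B +ₚ remainder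
      remainder-degreeBelow : DegreeBelow k remainder

  longDivision : ∀ B k → DegreeBelow (suc k) B → ∀ b' → b' * coeff B k ≡ₘ + 1 → ∀ L A → DegreeBelow L A → Division A B k
  longDivision B k B<k+1 b' b'bₖ≡1 zero    A A<0 = division [] A (≈-refl {A}) (degreeBelow-mono {P = A} z≤n A<0)
  longDivision B k B<k+1 b' b'bₖ≡1 (suc L) A A<L+1 with suc L ℕ.≤? k
  ... | yes L+1≤k = division [] A (≈-refl {A}) (degreeBelow-mono {P = A} L+1≤k A<L+1)
  ... | no  L+1≰k = division (quotient +ₚ C *ₚ Xpow j) remainder A≈ remainder-degreeBelow
    where
    k≤L : k ℕ.≤ L
    k≤L = ℕP.≤-pred (ℕP.≰⇒> L+1≰k)
    j = L ℕ.∸ k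
    C = constₚ (coeff A L * b')
    Y = C *ₚ (Xpow j *ₚ B)

    open Division (longDivision B k B<k+1 b' b'bₖ≡1 L (A -ₚ Y) (reduceDegree B k B<k+1 b' b'bₖ≡1 L A k≤L A<L+1))

    A≈ : A ≈ (quotient +ₚ C *ₚ Xpow j) *ₚ B +ₚ remainder
    A≈ = begin
      A                                         ≈⟨ //-rightDividesˡ Y A ⟨
      (A -ₚ Y) +ₚ Y                             ≈⟨ +ₚ-congʳ Y equation ⟩
      (quotient *ₚ B +ₚ remainder) +ₚ Y         ≈⟨ collect quotient B remainder C (Xpow j) ⟩
      (quotient +ₚ C *ₚ Xpow j) *ₚ B +ₚ remainder ∎
      where
      open ≈-Reasoning
      collect : ∀ Q B R C X → (Q *ₚ B +ₚ R) +ₚ C *ₚ (X *ₚ B) ≈ (Q +ₚ C *ₚ X) *ₚ B +ₚ R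
      collect = RingSolver.solve-∀ poly-almostRing

  module OverField (p-prime : Prime p) where

    pos-+*-identity : ∀ a b c d e → a ℕ.+ b ℕ.* c ≡ d ℕ.* e → + a + + b * + c ≡ + d * + e
    pos-+*-identity a b c d e eq = begin
      + a + + b * + c     ≡⟨ cong (_+_ (+ a)) (ℤP.pos-* b c) ⟨
      + a + + (b ℕ.* c)   ≡⟨ ℤP.pos-+ a (b ℕ.* c) ⟨
      + (a ℕ.+ b ℕ.* c)   ≡⟨ cong +_ eq ⟩
      + (d ℕ.* e)         ≡⟨ ℤP.pos-* d e ⟩
      + d * + e           ∎
      where open ≡.≡-Reasoning

    prime∤⇒coprime : ∀ {n} → ¬ p ℕ∣.∣ n → Coprime p n
    prime∤⇒coprime p∤n (d∣p , d∣n) with prime⇒irreducible p-prime d∣p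
    ... | inj₁ d≡1 = d≡1
    ... | inj₂ refl = ⊥-elim (p∤n d∣n)

    inverseℕ : ∀ n → ¬ p ℕ∣.∣ n → Σ ℤ λ c → c * + n ≡ₘ + 1
    inverseℕ n p∤n with coprime-Bézout (prime∤⇒coprime p∤n)
    ... | Bézout.+- x y eq = - + y , (begin
      - + y * + n                        ≈⟨ +-multiple-≡ₘ _ (+ x) ⟨
      - + y * + n + + x * + p            ≡⟨ cong (_+_ (- + y * + n)) (pos-+*-identity 1 y n x p eq) ⟨
      - + y * + n + (+ 1 + + y * + n)    ≡⟨ cancel (+ y) (+ n) ⟩
      + 1                                ∎)
      where
      open ≡ₘ-Reasoning
      cancel : ∀ y n → - y * n + (+ 1 + y * n) ≡ + 1
      cancel = solve-∀
    ... | Bézout.-+ x y eq = + y , (begin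
      + y * + n                          ≡⟨ pos-+*-identity 1 x p y n eq ⟨
      + 1 + + x * + p                    ≈⟨ +-multiple-≡ₘ (+ 1) (+ x) ⟩
      + 1                                ∎)
      where open ≡ₘ-Reasoning

    inverse : ∀ a → ¬ a ≡ₘ + 0 → Σ ℤ λ c → c * a ≡ₘ + 1
    inverse (+ n) a≢0 = inverseℕ n (a≢0 ∘ ∣⇒≡ₘ0 (+ n))
    inverse -[1+ k ] a≢0 with inverseℕ (suc k) (a≢0 ∘ ∣⇒≡ₘ0 -[1+ k ])
    ... | c , c*k≡1 = - c , ≡ₘ-trans (≡ₘ-reflexive (neg*neg c (+ suc k))) c*k≡1
      where
      neg*neg : ∀ c m → - c * - m ≡ c * m
      neg*neg = solve-∀

    constₚ-inverse : ∀ c' c → c' * c ≡ₘ + 1 → constₚ c' *ₚ constₚ c ≈ oneₚ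
    constₚ-inverse c' c c'c≡1 = ≈-trans (constₚ-*ₚ c' c) (constₚ-cong c'c≡1)

    record BézoutGcd (A B : Poly) : Set where
      constructor bézoutGcd
      field
        gcd U V : Poly
        bézout : gcd ≈ U *ₚ A +ₚ V *ₚ B
        gcd∣A : gcd ∣ₚ A
        gcd∣B : gcd ∣ₚ B

    bézoutGcd-below : ∀ n A B → DegreeBelow n B → BézoutGcd A B
    bézoutGcd-below zero A B B<0 =
      bézoutGcd A oneₚ [] (≈-sym (≈-trans (+ₚ-identityʳ _) (*ₚ-identityˡ A))) (∣ₚ-refl A)
                (divides [] (≈-trans (*ₚ-zeroʳ A) (≈-sym (degreeBelow-0⇒≈[] B<0))))
    bézoutGcd-below (suc k) A B B<k+1 with coeff B k ≡ₘ0?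
    ... | yes bₖ≡0 = bézoutGcd-below k A B B<k
      where
      B<k : DegreeBelow k B
      B<k i k≤i with ℕP.m≤n⇒m<n∨m≡n k≤i
      ... | inj₁ k<i  = B<k+1 i k<i
      ... | inj₂ refl = bₖ≡0
    ... | no bₖ≢0 with inverse (coeff B k) bₖ≢0
    ...   | b' , b'bₖ≡1 with longDivision B k B<k+1 b' b'bₖ≡1 (length A) A (degreeBelow-length A)
    ...     | division Q Rem A≈QB+Rem Rem<k with bézoutGcd-below k B Rem Rem<k
    ...       | bézoutGcd G U V G≈UB+VRem G∣B G∣Rem =
      bézoutGcd G V (U +ₚ M *ₚ (V *ₚ Q)) G≈ (∣ₚ-respʳ (≈-sym A≈QB+Rem) (∣ₚ-+ₚ (∣ₚ-*ₚ Q G∣B) G∣Rem)) G∣B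
      where
      open ≈-Reasoning
      M = -ₚ oneₚ
      Rem≈ : Rem ≈ A +ₚ M *ₚ (Q *ₚ B)
      Rem≈ = begin
        Rem                                ≈⟨ xyx⁻¹≈y (Q *ₚ B) Rem ⟨
        (Q *ₚ B +ₚ Rem) +ₚ -ₚ (Q *ₚ B)     ≈⟨ +ₚ-cong (≈-sym A≈QB+Rem) (≈-sym (-1*x≈-x (Q *ₚ B))) ⟩
        A +ₚ M *ₚ (Q *ₚ B)                 ∎
      G≈ : G ≈ V *ₚ A +ₚ (U +ₚ M *ₚ (V *ₚ Q)) *ₚ B
      G≈ = begin
        G                                       ≈⟨ G≈UB+VRem ⟩
        U *ₚ B +ₚ V *ₚ Rem                      ≈⟨ +ₚ-congˡ (U *ₚ B) (*ₚ-congˡ V Rem≈) ⟩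
        U *ₚ B +ₚ V *ₚ (A +ₚ M *ₚ (Q *ₚ B))     ≈⟨ regroup U B V A M Q ⟩
        V *ₚ A +ₚ (U +ₚ M *ₚ (V *ₚ Q)) *ₚ B     ∎
        where
        regroup : ∀ U B V A M Q → U *ₚ B +ₚ V *ₚ (A +ₚ M *ₚ (Q *ₚ B)) ≈ V *ₚ A +ₚ (U +ₚ M *ₚ (V *ₚ Q)) *ₚ B
        regroup = RingSolver.solve-∀ poly-almostRing

    relPrime⇒bézout : ∀ A B → RelPrime p A B → Σ Poly λ U → Σ Poly λ V → oneₚ ≈ U *ₚ A +ₚ V *ₚ B
    relPrime⇒bézout A B coprime with bézoutGcd-below (length B) A B (degreeBelow-length B)
    ... | bézoutGcd G U V G≈ G∣A G∣B with coprime G (∣ₚ⇒∣[p] G∣A) (∣ₚ⇒∣[p] G∣B)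
    ... | g≢0 , G<1 with inverse (coeff G 0) (g≢0 ∘ get)
    ... | g' , g'g≡1 = C *ₚ U , C *ₚ V , (begin
      oneₚ                                   ≈⟨ constₚ-inverse g' (coeff G 0) g'g≡1 ⟨
      C *ₚ constₚ (coeff G 0)                ≈⟨ *ₚ-congˡ C G≈g ⟨
      C *ₚ G                                 ≈⟨ *ₚ-congˡ C G≈ ⟩
      C *ₚ (U *ₚ A +ₚ V *ₚ B)                ≈⟨ distribute C U A V B ⟩
      (C *ₚ U) *ₚ A +ₚ (C *ₚ V) *ₚ B         ∎)
      where
      open ≈-Reasoning
      C = constₚ g'
      G≈g : G ≈ constₚ (coeff G 0)
      G≈g = pointwise λ { zero → ≡ₘ-refl ; (suc i) → mk (G<1 (suc i) (s≤s z≤n)) }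
      distribute : ∀ C U A V B → C *ₚ (U *ₚ A +ₚ V *ₚ B) ≈ (C *ₚ U) *ₚ A +ₚ (C *ₚ V) *ₚ B
      distribute = RingSolver.solve-∀ poly-almostRing

    relPrime∧∣ₚ-*ₚ⇒∣ₚ : ∀ A B S → RelPrime p A B → A ∣ₚ B *ₚ S → A ∣ₚ S
    relPrime∧∣ₚ-*ₚ⇒∣ₚ A B S coprime = let U , V , 1≈UA+VB = relPrime⇒bézout A B coprime in bézout∧∣ₚ-*ₚ⇒∣ₚ U V S 1≈UA+VB

    ∣ₚ-constₚ-*ₚ⇒∣ₚ : ∀ {R A c} → ¬ c ≡ₘ + 0 → R ∣ₚ constₚ c *ₚ A → R ∣ₚ A
    ∣ₚ-constₚ-*ₚ⇒∣ₚ {R} {A} {c} c≢0 R∣cA with inverse c c≢0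
    ... | c' , c'c≡1 = ∣ₚ-respʳ c'[cA]≈A (∣ₚ-*ₚ (constₚ c') R∣cA)
      where
      c'[cA]≈A : constₚ c' *ₚ (constₚ c *ₚ A) ≈ A
      c'[cA]≈A = ≈-trans (≈-sym (*ₚ-assoc (constₚ c') (constₚ c) A)) (≈-trans (*ₚ-congʳ A (constₚ-inverse c' c c'c≡1)) (*ₚ-identityˡ A))

    derivCofactor≈[]⇒∣ₚ : ∀ {c} R S → ¬ c ≡ₘ + 0 → derivCofactor c R S ≈ [] → R ∣ₚ deriv R *ₚ S
    derivCofactor≈[]⇒∣ₚ {c} R S c≢0 W≈0 = ∣ₚ-constₚ-*ₚ⇒∣ₚ c≢0 (divides (-ₚ deriv S) (≈-sym (begin
      constₚ c *ₚ (deriv R *ₚ S)       ≈⟨ inverseˡ-unique _ _ W≈0 ⟩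
      -ₚ (R *ₚ deriv S)                 ≈⟨ -‿distribʳ-* R (deriv S) ⟩
      R *ₚ -ₚ deriv S                   ∎)))
      where open ≈-Reasoning

open import Data.Nat using (_+_; _≤_)
open import Data.Nat.Divisibility using (_∣_)

lemma6 : (p : ℕ) → Prime p → (R S : Poly) → (dR dS : ℕ)
       → HasDegree p R dR → HasDegree p S dS → 1 ≤ dR
       → coeff R 0 ≡[ p ] + 1 → coeff S 0 ≡[ p ] + 1
       → RelPrime p R (deriv R) → ¬ (R ∣[ p ] S)
       → (m : ℕ) → 1 ≤ m → ¬ (p ∣ m)
       → ¬ (Xpow (dR + dS + 1) ∣[ p ] (((R ^ₚ m) *ₚ S) -ₚ oneₚ))
lemma6 p p-prime R S dR dS R° S° _ R₀≡1 _ coprime R∤S (suc k) _ p∤m (Q , XQ≈F-1) =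
  R∤S (∣ₚ⇒∣[p] (relPrime∧∣ₚ-*ₚ⇒∣ₚ R (deriv R) S coprime R∣R'S))
  where
  open PolynomialsModulo p
  open OverField p-prime
  W≈0 : derivCofactor (+ suc k) R S ≈ []
  W≈0 = Xpow∣R^mS-1⇒derivCofactor≈[] R S k Q (mk R₀≡1) (hasDegree⇒degreeBelow R R°) (hasDegree⇒degreeBelow S S°)
                                  (pointwise (mk ∘ XQ≈F-1))
  R∣R'S : R ∣ₚ deriv R *ₚ S
  R∣R'S = derivCofactor≈[]⇒∣ₚ R S (p∤m ∘ ≡ₘ0⇒∣ (+ suc k)) W≈0
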